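{- Let $D$ be an Eulerian digraph that immerses a digraph $D'$. Then $D$ immerses an Eulerian multi-digraph $D''$ on the same vertex set as $D'$ that contains $D'$ as a subdigraph.
   Context: Digraphs have no loops and at most one copy of each ordered edge $xy$ (both $xy$ and $yx$ may appear); multi-digraphs (without loops) may contain several copies of an edge $xy$. A (multi-)digraph is Eulerian if at every vertex the in-degree equals the out-degree, degrees counted with multiplicity. A (multi-)digraph $G$ immerses $H$ if there is an injective map $f: V(H) \to V(G)$ and pairwise edge-disjoint directed paths $P_e$ in $G$, one for each edge $e=uv$ of $H$ (each copy of a multiple edge being a separate edge), such that $P_e$ goes from $f(u)$ to $f(v)$. -}

module Defs where

open import Data.Nat using (ℕ)
open import Data.Fin using (Fin)
open import Data.Product using (Σ; _×_; _,_; proj₁; proj₂)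
open import Data.List using (List; []; _∷_; length; lookup; map; filter; concatMap; _++_)
open import Data.List.Relation.Unary.All using (All)
open import Data.List.Relation.Unary.All.Properties using (++⁺)
open import Data.List.Relation.Unary.Unique.Propositional using (Unique)
open import Data.Fin.Properties using (_≟_)
open import Relation.Binary.PropositionalEquality using (_≡_; _≢_)
open import Function.Definitions using (Injective)

-- Each list entry is a separate edge, so
-- repeated entries are parallel copies of an edge.
record MultiDigraph : Set where
  constructor mdg
  field
    n        : ℕ
    edges    : List (Fin n × Fin n)
    loopless : All (λ e → proj₁ e ≢ proj₂ e) edges
open MultiDigraph public

IsDigraph : MultiDigraph → Set
IsDigraph G = Unique (edges G)

EdgeId : MultiDigraph → Set
EdgeId G = Fin (length (edges G))

src : (G : MultiDigraph) → EdgeId G → Fin (n G)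
src G i = proj₁ (lookup (edges G) i)

tgt : (G : MultiDigraph) → EdgeId G → Fin (n G)
tgt G i = proj₂ (lookup (edges G) i)

outdeg : (G : MultiDigraph) → Fin (n G) → ℕ
outdeg G v = length (filter (λ e → proj₁ e ≟ v) (edges G))

indeg : (G : MultiDigraph) → Fin (n G) → ℕ
indeg G v = length (filter (λ e → proj₂ e ≟ v) (edges G))

Eulerian : MultiDigraph → Set
Eulerian G = (v : Fin (n G)) → indeg G v ≡ outdeg G v

data Walk (G : MultiDigraph) : Fin (n G) → Fin (n G) → List (EdgeId G) → Set where
  nil  : ∀ {a} → Walk G a a []
  cons : ∀ {a b es} (i : EdgeId G) → src G i ≡ a → Walk G (tgt G i) b es →
         Walk G a b (i ∷ es)

walkVertices : (G : MultiDigraph) → Fin (n G) → List (EdgeId G) → List (Fin (n G))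
walkVertices G a es = a ∷ map (tgt G) es

Path : (G : MultiDigraph) → Fin (n G) → Fin (n G) → List (EdgeId G) → Set
Path G a b es = Walk G a b es × Unique (walkVertices G a es)

-- An immersion of H in G: an injective vertex map f and, for every edge
-- e = uv of H (each list entry separately), a directed path P e in G from
-- f u to f v, such that the paths are pairwise edge-disjoint (no edge of G,
-- i.e. no edge index, is used twice in total).
record Immersion (G H : MultiDigraph) : Set where
  field
    f        : Fin (n H) → Fin (n G)
    f-inj    : Injective _≡_ _≡_ f
    P        : EdgeId H → List (EdgeId G)
    P-path   : (e : EdgeId H) → Path G (f (src H e)) (f (tgt H e)) (P e)
    disjoint : (e₁ e₂ : EdgeId H) → e₁ ≢ e₂ →
               All (λ x → All (λ y → x ≢ y) (P e₂)) (P e₁)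

Immerses : MultiDigraph → MultiDigraph → Set
Immerses G H = Immersion G H

addEdges : (H : MultiDigraph) (X : List (Fin (n H) × Fin (n H))) →
           All (λ e → proj₁ e ≢ proj₂ e) X → MultiDigraph
addEdges H X lX = mdg (n H) (edges H ++ X) (++⁺ (loopless H) lX)

{-# OPTIONS --safe #-}
module Submission where

-- Let U be the edges of D used by the immersion paths and A the unused ones, and write
-- imbalance for out-degree minus in-degree. As D is Eulerian, A has at every vertex the
-- negated imbalance of U, which is the imbalance of D′ pushed forward along f; in
-- particular it vanishes off the image of f. While some vertex w has positive imbalance
-- in A, following unused out-edges from w must reach a vertex z of negative imbalance;
-- both w and z lie in the image of f, so shortcutting this walk to a path routes a new
-- edge f⁻¹ w → f⁻¹ z of D″, and the walk's edges are removed from A. Once no vertex has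
-- positive imbalance, all imbalances vanish because they sum to zero, so the added edges
-- exactly cancel the imbalance of D′.

open import Data.Bool using (if_then_else_)
open import Data.Empty using (⊥-elim)
open import Data.Fin using (Fin; zero; suc)
open import Data.Fin.Properties using (_≟_; any?)
open import Data.Integer as ℤ using (ℤ; 0ℤ; 1ℤ; -1ℤ; _+_; _-_; -_; _≤_; _<_)
import Data.Integer.Properties as ℤP
open import Data.Integer.Tactic.RingSolver using (solve-∀)
open import Data.List
  using (List; []; _∷_; [_]; _++_; map; concat; filter; length; lookup; allFin; tabulate)
import Data.List.Properties as LP
open import Data.List.Membership.Propositional using (_∈_)
open import Data.List.Membership.Propositional.Properties
  using (∈-map⁻; ∈-∃++; ∈-++⁺ˡ; ∈-++⁺ʳ; ∈-lookup; ∈-allFin)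
open import Data.List.Relation.Binary.Disjoint.Propositional using (Disjoint)
open import Data.List.Relation.Binary.Permutation.Propositional as ↭ using (_↭_; ↭⇒↭ₛ)
import Data.List.Relation.Binary.Permutation.Propositional.Properties as ↭P
import Data.List.Relation.Binary.Permutation.Setoid.Properties as ↭ₛ
open import Data.List.Relation.Binary.Subset.Propositional using (_⊆_)
import Data.List.Relation.Binary.Subset.Propositional.Properties as ⊆P
open import Data.List.Relation.Unary.All as All using (All; []; _∷_)
import Data.List.Relation.Unary.All.Properties as AllP
open import Data.List.Relation.Unary.AllPairs using ([]; _∷_)
import Data.List.Relation.Unary.AllPairs.Properties as AllPairsP
open import Data.List.Relation.Unary.Any using (here; there)
open import Data.List.Relation.Unary.Unique.Propositional using (Unique)
import Data.List.Relation.Unary.Unique.Propositional.Properties as UniqueP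
open import Data.Nat as ℕ using (ℕ; suc)
open import Data.Nat.Induction using (<-wellFounded)
import Data.Nat.Properties as ℕP
open import Data.Product as Product using (Σ; ∃; _×_; _,_; proj₁; proj₂)
open import Function using (_∘_)
open import Function.Definitions using (Injective)
open import Induction.WellFounded using (Acc; acc)
open import Relation.Binary.PropositionalEquality as ≡
  using (_≡_; _≢_; refl; sym; trans; cong; cong₂; subst; subst₂; module ≡-Reasoning)
open import Relation.Nullary using (Dec; does; yes; no; ¬_)
open import Relation.Unary using (Decidable)

open import Algebra.Properties.CommutativeMonoid.Sum ℤP.+-0-commutativeMonoid
  using (sum; ∑-distrib-+; sum-replicate-zero)
open import Algebra.Properties.CommutativeSemigroup ℤP.+-commutativeSemigroup using (x∙yz≈y∙xz)

open import Defs

module _ {a} {A : Set a} where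

  Unique-resp-↭ : ∀ {xs ys : List A} → xs ↭ ys → Unique xs → Unique ys
  Unique-resp-↭ p = ↭ₛ.Unique-resp-↭ (≡.setoid A) (↭⇒↭ₛ p)

  Unique-++⁻ʳ : ∀ xs {ys : List A} → Unique (xs ++ ys) → Unique ys
  Unique-++⁻ʳ []       u       = u
  Unique-++⁻ʳ (x ∷ xs) (_ ∷ u) = Unique-++⁻ʳ xs u

  Unique-++⇒Disjoint : ∀ xs {ys : List A} → Unique (xs ++ ys) → Disjoint xs ys
  Unique-++⇒Disjoint (x ∷ xs) (x∉ ∷ _) (here refl , y∈) = All.lookup x∉ (∈-++⁺ʳ xs y∈) refl
  Unique-++⇒Disjoint (x ∷ xs) (_ ∷ u)  (there x∈ , y∈)  = Unique-++⇒Disjoint xs u (x∈ , y∈)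

  Disjoint⇒All≢ : ∀ {xs ys : List A} → Disjoint xs ys →
                  All (λ x → All (λ y → x ≢ y) ys) xs
  Disjoint⇒All≢ disjoint = All.tabulate λ x∈ →
    All.tabulate λ y∈ x≡y → disjoint (x∈ , subst (_∈ _) (sym x≡y) y∈)

  All≢⇒Disjoint : ∀ {xs ys : List A} → All (λ x → All (λ y → x ≢ y) ys) xs →
                  Disjoint xs ys
  All≢⇒Disjoint all≢ (x∈ , x∈′) = All.lookup (All.lookup all≢ x∈) x∈′ refl

  ⊆⇒↭-++ : ∀ {U E : List A} → Unique U → U ⊆ E → ∃ λ R → E ↭ U ++ R
  ⊆⇒↭-++ {[]}    {E} _         _   = E , ↭.refl
  ⊆⇒↭-++ {x ∷ U} {E} (x∉ ∷ uU) U⊆E with ys , zs , refl ← ∈-∃++ (U⊆E (here refl)) =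
    Product.map₂ (λ p → ↭.trans (↭P.shift x ys zs) (↭.prep x p)) (⊆⇒↭-++ uU U⊆ys++zs)
    where
    U⊆ys++zs : U ⊆ ys ++ zs
    U⊆ys++zs y∈U with ↭P.∈-resp-↭ (↭P.shift x ys zs) (U⊆E (there y∈U))
    ... | here refl = ⊥-elim (All.lookup x∉ y∈U refl)
    ... | there y∈  = y∈

module _ {a} {A : Set a} {P : A → Set} where

  All-lookupᶠ : ∀ {xs} → All P xs → (i : Fin (length xs)) → P (lookup xs i)
  All-lookupᶠ (px ∷ _)   zero    = px
  All-lookupᶠ (_  ∷ pxs) (suc i) = All-lookupᶠ pxs i

  All-tabulateᶠ : ∀ xs → ((i : Fin (length xs)) → P (lookup xs i)) → All P xs
  All-tabulateᶠ []       _ = []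
  All-tabulateᶠ (x ∷ xs) g = g zero ∷ All-tabulateᶠ xs (g ∘ suc)

indicator : ∀ {p} {P : Set p} → Dec P → ℤ
indicator d = ℤ.+ (if does d then 1 else 0)

indicator-yes : ∀ {p} {P : Set p} (d : Dec P) → P → indicator d ≡ 1ℤ
indicator-yes (yes _) _ = refl
indicator-yes (no ¬p) p = ⊥-elim (¬p p)

indicator-no : ∀ {p} {P : Set p} (d : Dec P) → ¬ P → indicator d ≡ 0ℤ
indicator-no (yes p) ¬p = ⊥-elim (¬p p)
indicator-no (no _)  _  = refl

indicator-cong : ∀ {p q} {P : Set p} {Q : Set q} (d : Dec P) (e : Dec Q) →
                 (P → Q) → (Q → P) → indicator d ≡ indicator e
indicator-cong (yes p) e P→Q _   = sym (indicator-yes e (P→Q p))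
indicator-cong (no ¬p) e _   Q→P = sym (indicator-no e (¬p ∘ Q→P))

+length-filter-∷ : ∀ {a p} {A : Set a} {P : A → Set p} (P? : Decidable P) x xs →
                   ℤ.+ length (filter P? (x ∷ xs)) ≡ indicator (P? x) + ℤ.+ length (filter P? xs)
+length-filter-∷ P? x xs with P? x
... | yes _ = refl
... | no _  = refl

module _ {k : ℕ} where

  arcImbalance : Fin k × Fin k → Fin k → ℤ
  arcImbalance e v = indicator (proj₁ e ≟ v) - indicator (proj₂ e ≟ v)

  imbalance : List (Fin k × Fin k) → Fin k → ℤ
  imbalance []      v = 0ℤ
  imbalance (e ∷ L) v = arcImbalance e v + imbalance L v

  imbalance-++ : ∀ L M v → imbalance (L ++ M) v ≡ imbalance L v + imbalance M v
  imbalance-++ []      M v = sym (ℤP.+-identityˡ (imbalance M v))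
  imbalance-++ (e ∷ L) M v =
    trans (cong (arcImbalance e v +_) (imbalance-++ L M v))
          (sym (ℤP.+-assoc (arcImbalance e v) (imbalance L v) (imbalance M v)))

  imbalance-↭ : ∀ {L M} → L ↭ M → ∀ v → imbalance L v ≡ imbalance M v
  imbalance-↭ ↭.refl        v = refl
  imbalance-↭ (↭.prep e p)  v = cong (arcImbalance e v +_) (imbalance-↭ p v)
  imbalance-↭ {M = _ ∷ _ ∷ M} (↭.swap e e′ p) v =
    trans (cong (λ t → arcImbalance e v + (arcImbalance e′ v + t)) (imbalance-↭ p v))
          (x∙yz≈y∙xz (arcImbalance e v) (arcImbalance e′ v) (imbalance M v))
  imbalance-↭ (↭.trans p q) v = trans (imbalance-↭ p v) (imbalance-↭ q v)

  imbalance-degrees : ∀ L v → imbalance L v ≡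
    ℤ.+ length (filter (λ e → proj₁ e ≟ v) L) - ℤ.+ length (filter (λ e → proj₂ e ≟ v) L)
  imbalance-degrees []      v = refl
  imbalance-degrees (e ∷ L) v = begin
    arcImbalance e v + imbalance L v
      ≡⟨ cong (arcImbalance e v +_) (imbalance-degrees L v) ⟩
    (out₁ - in₁) + (ℤ.+ outs - ℤ.+ ins)
      ≡⟨ regroup out₁ in₁ (ℤ.+ outs) (ℤ.+ ins) ⟩
    (out₁ + ℤ.+ outs) - (in₁ + ℤ.+ ins)
      ≡⟨ cong₂ _-_ (+length-filter-∷ (λ e → proj₁ e ≟ v) e L)
                   (+length-filter-∷ (λ e → proj₂ e ≟ v) e L) ⟨
    ℤ.+ length (filter (λ e → proj₁ e ≟ v) (e ∷ L)) -
    ℤ.+ length (filter (λ e → proj₂ e ≟ v) (e ∷ L)) ∎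
    where
    open ≡-Reasoning
    out₁ = indicator (proj₁ e ≟ v)
    in₁  = indicator (proj₂ e ≟ v)
    outs = length (filter (λ e → proj₁ e ≟ v) L)
    ins  = length (filter (λ e → proj₂ e ≟ v) L)
    regroup : ∀ a b c d → (a - b) + (c - d) ≡ (a + c) - (b + d)
    regroup = solve-∀

eulerian⇒balanced : ∀ G → Eulerian G → ∀ v → imbalance (edges G) v ≡ 0ℤ
eulerian⇒balanced G eulerian v = begin
  imbalance (edges G) v            ≡⟨ imbalance-degrees (edges G) v ⟩
  ℤ.+ outdeg G v - ℤ.+ indeg G v   ≡⟨ cong (λ d → ℤ.+ outdeg G v - ℤ.+ d) (eulerian v) ⟩
  ℤ.+ outdeg G v - ℤ.+ outdeg G v  ≡⟨ ℤP.+-inverseʳ (ℤ.+ outdeg G v) ⟩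
  0ℤ                               ∎
  where open ≡-Reasoning

balanced⇒eulerian : ∀ G → (∀ v → imbalance (edges G) v ≡ 0ℤ) → Eulerian G
balanced⇒eulerian G balanced v =
  ℤP.+-injective (sym (ℤP.i-j≡0⇒i≡j _ _
    (trans (sym (imbalance-degrees (edges G) v)) (balanced v))))

∑-indicator : ∀ {k} (x : Fin k) → sum (λ v → indicator (x ≟ v)) ≡ 1ℤ
∑-indicator {suc k} zero    = cong (1ℤ +_) (sum-replicate-zero k)
∑-indicator {suc k} (suc x) = trans (ℤP.+-identityˡ _) (∑-indicator x)

∑-neg : ∀ {k} (g : Fin k → ℤ) → sum (λ v → - g v) ≡ - sum g
∑-neg {ℕ.zero} g = refl
∑-neg {suc k}  g = trans (cong (- g zero +_) (∑-neg (g ∘ suc)))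
                         (sym (ℤP.neg-distrib-+ (g zero) (sum (g ∘ suc))))

∑-arcImbalance : ∀ {k} (e : Fin k × Fin k) → sum (arcImbalance e) ≡ 0ℤ
∑-arcImbalance (a , b) = begin
  sum (arcImbalance (a , b))
    ≡⟨ ∑-distrib-+ (λ v → indicator (a ≟ v)) (λ v → - indicator (b ≟ v)) ⟩
  sum (λ v → indicator (a ≟ v)) + sum (λ v → - indicator (b ≟ v))
    ≡⟨ cong₂ _+_ (∑-indicator a)
                 (trans (∑-neg (λ v → indicator (b ≟ v))) (cong -_ (∑-indicator b))) ⟩
  1ℤ - 1ℤ ∎
  where open ≡-Reasoning

∑-imbalance : ∀ {k} (L : List (Fin k × Fin k)) → sum (imbalance L) ≡ 0ℤ
∑-imbalance {k} []      = sum-replicate-zero k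
∑-imbalance     (e ∷ L) = trans (∑-distrib-+ (arcImbalance e) (imbalance L))
                                (cong₂ _+_ (∑-arcImbalance e) (∑-imbalance L))

i≡0∧i+j≡0⇒j≡0 : ∀ {i j} → i ≡ 0ℤ → i + j ≡ 0ℤ → j ≡ 0ℤ
i≡0∧i+j≡0⇒j≡0 {j = j} refl i+j≡0 = trans (sym (ℤP.+-identityˡ j)) i+j≡0

sum-nonpos : ∀ {k} (g : Fin k → ℤ) → (∀ v → g v ≤ 0ℤ) → sum g ≤ 0ℤ
sum-nonpos {ℕ.zero} g _   = ℤP.≤-refl
sum-nonpos {suc k}  g g≤0 = ℤP.+-mono-≤ (g≤0 zero) (sum-nonpos (g ∘ suc) (g≤0 ∘ suc))

sum-nonpos≡0 : ∀ {k} (g : Fin k → ℤ) → (∀ v → g v ≤ 0ℤ) → sum g ≡ 0ℤ → ∀ v → g v ≡ 0ℤ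
sum-nonpos≡0 {suc k} g g≤0 ∑g≡0 = λ
  { zero    → g₀≡0
  ; (suc v) → sum-nonpos≡0 (g ∘ suc) (g≤0 ∘ suc) rest≡0 v }
  where
  rest = sum (g ∘ suc)
  g₀≡0 : g zero ≡ 0ℤ
  g₀≡0 = ℤP.≤-antisym (g≤0 zero) (begin
    0ℤ             ≡⟨ ∑g≡0 ⟨
    g zero + rest  ≤⟨ ℤP.+-monoʳ-≤ (g zero) (sum-nonpos (g ∘ suc) (g≤0 ∘ suc)) ⟩
    g zero + 0ℤ    ≡⟨ ℤP.+-identityʳ (g zero) ⟩
    g zero         ∎)
    where open ℤP.≤-Reasoning
  rest≡0 : rest ≡ 0ℤ
  rest≡0 = i≡0∧i+j≡0⇒j≡0 g₀≡0 ∑g≡0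

no-surplus⇒balanced : ∀ {k} (L : List (Fin k × Fin k)) →
                      (∀ v → ¬ 0ℤ < imbalance L v) → ∀ v → imbalance L v ≡ 0ℤ
no-surplus⇒balanced L no-surplus =
  sum-nonpos≡0 (imbalance L) (λ v → ℤP.≮⇒≥ (no-surplus v)) (∑-imbalance L)

arcImbalance-≤-out : ∀ {k} (e : Fin k × Fin k) v → arcImbalance e v ≤ indicator (proj₁ e ≟ v)
arcImbalance-≤-out e v = ℤP.i-j≤i (indicator (proj₁ e ≟ v)) (indicator (proj₂ e ≟ v))

surplus⇒out-arc : ∀ {k} (L : List (Fin k × Fin k)) z → 0ℤ < imbalance L z →
                  ∃ λ e → e ∈ L × proj₁ e ≡ z
surplus⇒out-arc []      z surplus = ⊥-elim (ℤP.<-irrefl refl surplus)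
surplus⇒out-arc (e ∷ L) z surplus with proj₁ e ≟ z
... | yes e-out = e , here refl , e-out
... | no  _     =
  Product.map₂ (Product.map₁ there) (surplus⇒out-arc L z (ℤP.<-≤-trans surplus (begin
  0ℤ - indicator (proj₂ e ≟ z) + imbalance L z
    ≤⟨ ℤP.+-monoˡ-≤ (imbalance L z) (ℤP.i-j≤i 0ℤ (indicator (proj₂ e ≟ z))) ⟩
  0ℤ + imbalance L z
    ≡⟨ ℤP.+-identityˡ (imbalance L z) ⟩
  imbalance L z ∎)))
  where open ℤP.≤-Reasoning

module _ {k k′ : ℕ} {f : Fin k → Fin k′} where

  imbalance-map-injective : Injective _≡_ _≡_ f → ∀ L u →
                            imbalance (map (Product.map f f) L) (f u) ≡ imbalance L u
  imbalance-map-injective f-inj []            u = refl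
  imbalance-map-injective f-inj ((a , b) ∷ L) u =
    cong₂ _+_ (cong₂ _-_ (same a) (same b)) (imbalance-map-injective f-inj L u)
    where
    same : ∀ x → indicator (f x ≟ f u) ≡ indicator (x ≟ u)
    same x = indicator-cong (f x ≟ f u) (x ≟ u) f-inj (cong f)

  imbalance-map-outside : ∀ {v} → (∀ u → f u ≢ v) → ∀ L →
                          imbalance (map (Product.map f f) L) v ≡ 0ℤ
  imbalance-map-outside         _       []            = refl
  imbalance-map-outside {v = v} outside ((a , b) ∷ L) =
    cong₂ _+_ (cong₂ _-_ (indicator-no (f a ≟ v) (outside a))
                         (indicator-no (f b ≟ v) (outside b)))
              (imbalance-map-outside outside L)

module _ (D : MultiDigraph) where

  arcs : List (EdgeId D) → List (Fin (n D) × Fin (n D))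
  arcs = map (lookup (edges D))

  arcs-allFin : arcs (allFin (length (edges D))) ≡ edges D
  arcs-allFin = trans (LP.map-tabulate (λ i → i) (lookup (edges D))) (LP.tabulate-lookup (edges D))

  imbalance-arcs-↭ : ∀ {A B} → A ↭ B → ∀ v → imbalance (arcs A) v ≡ imbalance (arcs B) v
  imbalance-arcs-↭ p = imbalance-↭ (↭P.map⁺ (lookup (edges D)) p)

  imbalance-arcs-split : ∀ {A} W R → A ↭ W ++ R → ∀ v →
                         imbalance (arcs A) v ≡ imbalance (arcs W) v + imbalance (arcs R) v
  imbalance-arcs-split {A} W R p v = begin
    imbalance (arcs A) v                         ≡⟨ imbalance-arcs-↭ p v ⟩
    imbalance (arcs (W ++ R)) v                  ≡⟨ cong (λ L → imbalance L v) (LP.map-++ _ W R) ⟩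
    imbalance (arcs W ++ arcs R) v               ≡⟨ imbalance-++ (arcs W) (arcs R) v ⟩
    imbalance (arcs W) v + imbalance (arcs R) v  ∎
    where open ≡-Reasoning

  edge-loopless : ∀ i → src D i ≢ tgt D i
  edge-loopless i = All.lookup (loopless D) (∈-lookup i)

  surplus⇒out-edge : ∀ A z → 0ℤ < imbalance (arcs A) z → ∃ λ i → i ∈ A × src D i ≡ z
  surplus⇒out-edge A z surplus
    with e , e∈ , e-out ← surplus⇒out-arc (arcs A) z surplus
    with i , i∈A , refl ← ∈-map⁻ (lookup (edges D)) e∈ = i , i∈A , e-out

  imbalance-walk : ∀ {a b es} → Walk D a b es → ∀ v →
                   imbalance (arcs es) v ≡ indicator (a ≟ v) - indicator (b ≟ v)
  imbalance-walk {a} nil v = sym (ℤP.+-inverseʳ (indicator (a ≟ v)))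
  imbalance-walk {b = b} (cons i refl w) v =
    trans (cong (arcImbalance (lookup (edges D) i) v +_) (imbalance-walk w v))
          (ℤP.+-minus-telescope (indicator (src D i ≟ v)) (indicator (tgt D i ≟ v))
                                (indicator (b ≟ v)))

  walk-length-pos : ∀ {a b es} → Walk D a b es → a ≢ b → 0 ℕ.< length es
  walk-length-pos nil          a≢b = ⊥-elim (a≢b refl)
  walk-length-pos (cons _ _ _) _   = ℕ.s≤s ℕ.z≤n

  path-edges-unique : ∀ {a b es} → Path D a b es → Unique es
  path-edges-unique (_ , _ ∷ vertices-unique) = UniqueP.map⁻ vertices-unique

  suffix-path : ∀ {c b es} → Walk D c b es → Unique (walkVertices D c es) →
                ∀ {a} → a ∈ walkVertices D c es → ∃ λ es′ → Path D a b es′ × es′ ⊆ es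
  suffix-path w            vs-unique       (here refl) = _ , (w , vs-unique) , λ x∈ → x∈
  suffix-path (cons _ _ w) (_ ∷ vs-unique) (there a∈)  =
    Product.map₂ (Product.map₂ (λ es′⊆es x∈ → there (es′⊆es x∈))) (suffix-path w vs-unique a∈)

  open import Data.List.Membership.DecPropositional (_≟_ {n D}) using (_∈?_)

  shortcut : ∀ {a b es} → Walk D a b es → ∃ λ es′ → Path D a b es′ × es′ ⊆ es
  shortcut nil = [] , (nil , [] ∷ []) , λ ()
  shortcut {a} (cons i src≡a w) with shortcut w
  ... | es″ , (w″ , vs-unique) , es″⊆es with a ∈? walkVertices D (tgt D i) es″
  ...   | yes a∈ = Product.map₂ (Product.map₂ λ es′⊆es″ x∈ → there (es″⊆es (es′⊆es″ x∈)))
                                (suffix-path w″ vs-unique a∈)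
  ...   | no  a∉ = i ∷ es″ , (cons i src≡a w″ , AllP.¬Any⇒All¬ _ a∉ ∷ vs-unique) ,
                   λ { (here refl) → here refl ; (there x∈) → there (es″⊆es x∈) }

  record WalkToDeficit (A : List (EdgeId D)) (w : Fin (n D)) : Set where
    field
      end       : Fin (n D)
      walk rest : List (EdgeId D)
      isWalk    : Walk D w end walk
      split     : A ↭ walk ++ rest
      deficit   : imbalance (arcs A) end < 0ℤ

  surplus-passes-on : ∀ {A A₁ i} → A ↭ i ∷ A₁ → 0ℤ ≤ imbalance (arcs A) (tgt D i) →
                      0ℤ < imbalance (arcs A₁) (tgt D i)
  surplus-passes-on {A} {A₁} {i} A↭ balance≥0 = ℤP.suc[i]≤j⇒i<j (begin
    1ℤ + 0ℤ                                 ≤⟨ ℤP.+-monoʳ-≤ 1ℤ balance≥0 ⟩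
    1ℤ + imbalance (arcs A) t               ≡⟨ cong (1ℤ +_) (imbalance-arcs-↭ A↭ t) ⟩
    1ℤ + (arcImbalance (lookup (edges D) i) t + rest)
                                            ≡⟨ cong (λ a → 1ℤ + (a + rest)) out-edge ⟩
    1ℤ + (-1ℤ + rest)                       ≡⟨ ℤP.+-assoc 1ℤ -1ℤ rest ⟨
    0ℤ + rest                               ≡⟨ ℤP.+-identityˡ rest ⟩
    rest                                    ∎)
    where
    open ℤP.≤-Reasoning
    t = tgt D i
    rest = imbalance (arcs A₁) t
    out-edge : arcImbalance (lookup (edges D) i) t ≡ -1ℤ
    out-edge = cong₂ _-_ (indicator-no (src D i ≟ t) (edge-loopless i))
                         (indicator-yes (t ≟ t) refl)

  walkToDeficit-∷ : ∀ {A A₁ i w} → A ↭ i ∷ A₁ → src D i ≡ w → 0ℤ < imbalance (arcs A) w →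
                    WalkToDeficit A₁ (tgt D i) → WalkToDeficit A w
  walkToDeficit-∷ {A} {A₁} {i} {w} A↭ src≡w surplus dw = record
    { end     = end
    ; walk    = i ∷ walk
    ; rest    = rest
    ; isWalk  = cons i src≡w isWalk
    ; split   = ↭.trans A↭ (↭.prep i split)
    ; deficit = deficit′ }
    where
    open WalkToDeficit dw
    open ℤP.≤-Reasoning
    y = imbalance (arcs A₁) end
    bound : imbalance (arcs A) end ≤ indicator (w ≟ end) + y
    bound = begin
      imbalance (arcs A) end                     ≡⟨ imbalance-arcs-↭ A↭ end ⟩
      arcImbalance (lookup (edges D) i) end + y
        ≤⟨ ℤP.+-monoˡ-≤ y (arcImbalance-≤-out (lookup (edges D) i) end) ⟩
      indicator (src D i ≟ end) + y              ≡⟨ cong (λ x → indicator (x ≟ end) + y) src≡w ⟩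
      indicator (w ≟ end) + y                    ∎
    end≢w : end ≢ w
    end≢w end≡w = ℤP.<-irrefl refl (begin-strict
      0ℤ                       <⟨ subst (λ x → 0ℤ < imbalance (arcs A) x) (sym end≡w) surplus ⟩
      imbalance (arcs A) end   ≤⟨ bound ⟩
      indicator (w ≟ end) + y  ≡⟨ cong (_+ y) (indicator-yes (w ≟ end) (sym end≡w)) ⟩
      1ℤ + y                   ≤⟨ ℤP.i<j⇒suc[i]≤j deficit ⟩
      0ℤ                       ∎)
    deficit′ : imbalance (arcs A) end < 0ℤ
    deficit′ = begin-strict
      imbalance (arcs A) end   ≤⟨ bound ⟩
      indicator (w ≟ end) + y  ≡⟨ cong (_+ y) (indicator-no (w ≟ end) (end≢w ∘ sym)) ⟩
      0ℤ + y                   ≡⟨ ℤP.+-identityˡ y ⟩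
      y                        <⟨ deficit ⟩
      0ℤ                       ∎

  walkToDeficit : ∀ A {w} → Acc ℕ._<_ (length A) → 0ℤ < imbalance (arcs A) w → WalkToDeficit A w
  walkToDeficit A {w} (acc rs) surplus
    with i , i∈A , src≡w ← surplus⇒out-edge A w surplus
    with ys , zs , refl ← ∈-∃++ i∈A
    with imbalance (arcs (ys ++ i ∷ zs)) (tgt D i) ℤP.<? 0ℤ
  ... | yes deficit = record
    { end = tgt D i ; walk = [ i ] ; rest = ys ++ zs ; isWalk = cons i src≡w nil
    ; split = ↭P.shift i ys zs ; deficit = deficit }
  ... | no ¬deficit = walkToDeficit-∷ (↭P.shift i ys zs) src≡w surplus
    (walkToDeficit (ys ++ zs) (rs (ℕP.≤-reflexive (sym (LP.length-++-sucʳ ys i zs))))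
                   (surplus-passes-on (↭P.shift i ys zs) (ℤP.≮⇒≥ ¬deficit)))

module _ (D : MultiDigraph) {k : ℕ} (f : Fin k → Fin (n D)) where

  RoutedArc : Fin k × Fin k → Set
  RoutedArc e = ∃ (Path D (f (proj₁ e)) (f (proj₂ e)))

  routes : ∀ {L} → All RoutedArc L → List (EdgeId D)
  routes []       = []
  routes (p ∷ ps) = proj₁ p ++ routes ps

  routes-++ : ∀ {L M} (ps : All RoutedArc L) (qs : All RoutedArc M) →
              routes (AllP.++⁺ ps qs) ≡ routes ps ++ routes qs
  routes-++ []       qs = refl
  routes-++ (p ∷ ps) qs =
    trans (cong (proj₁ p ++_) (routes-++ ps qs))
          (sym (LP.++-assoc (proj₁ p) (routes ps) (routes qs)))

  routes-tabulate : ∀ L (g : (i : Fin (length L)) → RoutedArc (lookup L i)) →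
                    routes (All-tabulateᶠ L g) ≡ concat (tabulate (proj₁ ∘ g))
  routes-tabulate []      g = refl
  routes-tabulate (e ∷ L) g = cong (proj₁ (g zero) ++_) (routes-tabulate L (g ∘ suc))

  ∈-routes : ∀ {L} (ps : All RoutedArc L) i → proj₁ (All-lookupᶠ ps i) ⊆ routes ps
  ∈-routes (p ∷ _)  zero    = ∈-++⁺ˡ
  ∈-routes (p ∷ ps) (suc i) = ∈-++⁺ʳ (proj₁ p) ∘ ∈-routes ps i

  routes-disjoint : ∀ {L} (ps : All RoutedArc L) → Unique (routes ps) → ∀ i j → i ≢ j →
                    Disjoint (proj₁ (All-lookupᶠ ps i)) (proj₁ (All-lookupᶠ ps j))
  routes-disjoint (p ∷ ps) _ zero    zero    i≢j = ⊥-elim (i≢j refl)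
  routes-disjoint (p ∷ ps) u zero    (suc j) _   (x∈ , x∈′) =
    Unique-++⇒Disjoint (proj₁ p) u (x∈ , ∈-routes ps j x∈′)
  routes-disjoint (p ∷ ps) u (suc i) zero    _   (x∈ , x∈′) =
    Unique-++⇒Disjoint (proj₁ p) u (x∈′ , ∈-routes ps i x∈)
  routes-disjoint (p ∷ ps) u (suc i) (suc j) i≢j =
    routes-disjoint ps (Unique-++⁻ʳ (proj₁ p) u) i j (i≢j ∘ cong suc)

  imbalance-routes : ∀ {L} (ps : All RoutedArc L) v →
                     imbalance (arcs D (routes ps)) v ≡ imbalance (map (Product.map f f) L) v
  imbalance-routes                 []                       v = refl
  imbalance-routes {L = e ∷ L} ((es , walk , _) ∷ ps) v = begin
    imbalance (arcs D (es ++ routes ps)) v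
      ≡⟨ cong (λ L → imbalance L v) (LP.map-++ _ es (routes ps)) ⟩
    imbalance (arcs D es ++ arcs D (routes ps)) v
      ≡⟨ imbalance-++ (arcs D es) (arcs D (routes ps)) v ⟩
    imbalance (arcs D es) v + imbalance (arcs D (routes ps)) v
      ≡⟨ cong₂ _+_ (imbalance-walk D walk v) (imbalance-routes ps v) ⟩
    imbalance (map (Product.map f f) (e ∷ L)) v ∎
    where open ≡-Reasoning

  BalancedOffImage : List (EdgeId D) → Set
  BalancedOffImage A = ∀ v → (∀ u → f u ≢ v) → imbalance (arcs D A) v ≡ 0ℤ

  unbalanced⇒image : ∀ A → BalancedOffImage A → ∀ {v} → imbalance (arcs D A) v ≢ 0ℤ →
                     ∃ λ u → f u ≡ v
  unbalanced⇒image A balanced {v} unbalanced with any? (λ u → f u ≟ v)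
  ... | yes found = found
  ... | no  none  = ⊥-elim (unbalanced (balanced v (λ u fu≡v → none (u , fu≡v))))

  record Routing (A : List (EdgeId D)) : Set where
    field
      pairs          : List (Fin k × Fin k)
      pairs-loopless : All (λ e → proj₁ e ≢ proj₂ e) pairs
      paths          : All RoutedArc pairs
      routes-unique  : Unique (routes paths)
      routes-⊆       : routes paths ⊆ A
      balanced       : ∀ v → imbalance (map (Product.map f f) pairs) v ≡ imbalance (arcs D A) v

  routing-∷ : ∀ {A W R u₁ u₂} → Unique A → A ↭ W ++ R → Walk D (f u₁) (f u₂) W → f u₁ ≢ f u₂ →
              Routing R → Routing A
  routing-∷ {A} {W} {R} {u₁} {u₂} A-unique A↭ walk ends≢ r = record
    { pairs          = (u₁ , u₂) ∷ pairs
    ; pairs-loopless = (ends≢ ∘ cong f) ∷ pairs-loopless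
    ; paths          = (Q , Q-path) ∷ paths
    ; routes-unique  = UniqueP.++⁺ (path-edges-unique D Q-path) routes-unique
                         λ (x∈Q , x∈routes) →
                           Unique-++⇒Disjoint W WR-unique (Q⊆W x∈Q , routes-⊆ x∈routes)
    ; routes-⊆       = ↭P.∈-resp-↭ (↭.↭-sym A↭) ∘ ⊆P.++⁺ Q⊆W routes-⊆
    ; balanced       = λ v → trans (cong₂ _+_ (sym (imbalance-walk D walk v)) (balanced v))
                                   (sym (imbalance-arcs-split D W R A↭ v)) }
    where
    open Routing r
    Q      = proj₁ (shortcut D walk)
    Q-path = proj₁ (proj₂ (shortcut D walk))
    Q⊆W    = proj₂ (proj₂ (shortcut D walk))
    WR-unique : Unique (W ++ R)
    WR-unique = Unique-resp-↭ A↭ A-unique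

  routing : ∀ A → Acc ℕ._<_ (length A) → Unique A → BalancedOffImage A → Routing A
  routing A (acc rs) A-unique A-balanced with any? (λ w → 0ℤ ℤP.<? imbalance (arcs D A) w)
  ... | no ¬surplus = record
    { pairs = [] ; pairs-loopless = [] ; paths = [] ; routes-unique = [] ; routes-⊆ = λ ()
    ; balanced = λ v →
        sym (no-surplus⇒balanced (arcs D A) (λ w surplus → ¬surplus (w , surplus)) v) }
  ... | yes (w , surplus) =
    routing-∷ A-unique split walk′ (λ fu₁≡fu₂ → end≢w (trans (sym e₂) (trans (sym fu₁≡fu₂) e₁)))
      (routing rest (rs shorter) (Unique-++⁻ʳ walk (Unique-resp-↭ split A-unique)) rest-balanced)
    where
    open WalkToDeficit (walkToDeficit D A (acc rs) surplus)
    end≢w : end ≢ w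
    end≢w end≡w = ℤP.<-asym surplus (subst (λ x → imbalance (arcs D A) x < 0ℤ) end≡w deficit)
    start = unbalanced⇒image A A-balanced (λ eq → ℤP.<-irrefl (sym eq) surplus)
    finish = unbalanced⇒image A A-balanced (λ eq → ℤP.<-irrefl eq deficit)
    u₁ = proj₁ start
    e₁ = proj₂ start
    u₂ = proj₁ finish
    e₂ = proj₂ finish
    walk′ : Walk D (f u₁) (f u₂) walk
    walk′ = subst₂ (λ a b → Walk D a b walk) (sym e₁) (sym e₂) isWalk
    shorter : length rest ℕ.< length A
    shorter = ℕP.<-≤-trans (ℕP.m<n+m (length rest) (walk-length-pos D isWalk (end≢w ∘ sym)))
                (ℕP.≤-reflexive (sym (trans (↭P.↭-length split) (LP.length-++ walk))))
    rest-balanced : BalancedOffImage rest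
    rest-balanced v v∉f = i≡0∧i+j≡0⇒j≡0 walk-balanced
      (trans (sym (imbalance-arcs-split D walk rest split v)) (A-balanced v v∉f))
      where
      walk-balanced : imbalance (arcs D walk) v ≡ 0ℤ
      walk-balanced = trans (imbalance-walk D isWalk v)
        (cong₂ _-_ (indicator-no (w ≟ v) (λ w≡v → v∉f u₁ (trans e₁ w≡v)))
                   (indicator-no (end ≟ v) (λ end≡v → v∉f u₂ (trans e₂ end≡v))))

  unusedEdges : Eulerian D → ∀ {L} (ps : All RoutedArc L) → Unique (routes ps) →
                ∃ λ A → Unique (routes ps ++ A) ×
                        (∀ v → imbalance (arcs D (routes ps)) v + imbalance (arcs D A) v ≡ 0ℤ)
  unusedEdges D-eulerian ps ps-unique
    with A , allFin↭ ← ⊆⇒↭-++ ps-unique (λ {i} _ → ∈-allFin i) =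
    A , Unique-resp-↭ allFin↭ (UniqueP.allFin⁺ _) , λ v → begin
      imbalance (arcs D (routes ps)) v + imbalance (arcs D A) v
        ≡⟨ imbalance-arcs-split D (routes ps) A allFin↭ v ⟨
      imbalance (arcs D (allFin _)) v
        ≡⟨ cong (λ L → imbalance L v) (arcs-allFin D) ⟩
      imbalance (edges D) v
        ≡⟨ eulerian⇒balanced D D-eulerian v ⟩
      0ℤ ∎
    where open ≡-Reasoning

  unused-balancedOffImage : ∀ {L} (ps : All RoutedArc L) {A} →
    (∀ v → imbalance (arcs D (routes ps)) v + imbalance (arcs D A) v ≡ 0ℤ) → BalancedOffImage A
  unused-balancedOffImage {L} ps {A} cancel v v∉f = i≡0∧i+j≡0⇒j≡0 used-balanced (cancel v)
    where
    used-balanced : imbalance (arcs D (routes ps)) v ≡ 0ℤ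
    used-balanced = trans (imbalance-routes ps v) (imbalance-map-outside v∉f L)

module _ {D H : MultiDigraph} where

  immersion⇒paths : (imm : Immersion D H) → let open Immersion imm in
                    Σ (All (RoutedArc D f) (edges H)) (Unique ∘ routes D f)
  immersion⇒paths imm =
    ps , subst Unique (sym (routes-tabulate D f (edges H) path)) (UniqueP.concat⁺
      (AllP.tabulate⁺ (λ e → path-edges-unique D (P-path e)))
      (AllPairsP.tabulate⁺ (λ e≢e′ → All≢⇒Disjoint (disjoint _ _ e≢e′))))
    where
    open Immersion imm
    path : (e : EdgeId H) → RoutedArc D f (lookup (edges H) e)
    path e = P e , P-path e
    ps = All-tabulateᶠ (edges H) path

  paths⇒immersion : ∀ {f} → Injective _≡_ _≡_ f → (ps : All (RoutedArc D f) (edges H)) →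
                    Unique (routes D f ps) → Immersion D H
  paths⇒immersion {f} f-inj ps ps-unique = record
    { f        = f
    ; f-inj    = f-inj
    ; P        = λ e → proj₁ (All-lookupᶠ ps e)
    ; P-path   = λ e → proj₂ (All-lookupᶠ ps e)
    ; disjoint = λ e e′ e≢e′ → Disjoint⇒All≢ (routes-disjoint D f ps ps-unique e e′ e≢e′) }

-- The argument never uses that D and D′ are digraphs: it works for multi-digraphs.
lemma2p2 : (D D′ : MultiDigraph) → IsDigraph D → IsDigraph D′ → Eulerian D →
           Immerses D D′ →
           Σ (List (Fin (n D′) × Fin (n D′))) λ X →
             Σ (All (λ e → proj₁ e ≢ proj₂ e) X) λ lX →
               Eulerian (addEdges D′ X lX) × Immerses D (addEdges D′ X lX)
lemma2p2 D D′ _ _ D-eulerian imm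
  with ps₀ , ps₀-unique ← immersion⇒paths imm
  with A , UA-unique , UA-cancel ← unusedEdges D (Immersion.f imm) D-eulerian ps₀ ps₀-unique =
  pairs , pairs-loopless , balanced⇒eulerian (addEdges D′ pairs pairs-loopless) D″-balanced ,
  paths⇒immersion f-inj (AllP.++⁺ ps₀ paths)
    (subst Unique (sym (routes-++ D f ps₀ paths)) all-unique)
  where
  open Immersion imm using (f; f-inj)
  U = routes D f ps₀
  open Routing (routing D f A (<-wellFounded _) (Unique-++⁻ʳ U UA-unique)
                             (unused-balancedOffImage D f ps₀ {A} UA-cancel))
  all-unique : Unique (U ++ routes D f paths)
  all-unique = UniqueP.++⁺ ps₀-unique routes-unique
    (λ (x∈U , x∈paths) → Unique-++⇒Disjoint U UA-unique (x∈U , routes-⊆ x∈paths))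
  D″-balanced : ∀ u → imbalance (edges D′ ++ pairs) u ≡ 0ℤ
  D″-balanced u = begin
    imbalance (edges D′ ++ pairs) u
      ≡⟨ imbalance-++ (edges D′) pairs u ⟩
    imbalance (edges D′) u + imbalance pairs u
      ≡⟨ cong₂ _+_ (imbalance-map-injective f-inj (edges D′) u)
                   (imbalance-map-injective f-inj pairs u) ⟨
    imbalance (map (Product.map f f) (edges D′)) (f u) + imbalance (map (Product.map f f) pairs) (f u)
      ≡⟨ cong₂ _+_ (imbalance-routes D f ps₀ (f u)) (sym (balanced (f u))) ⟨
    imbalance (arcs D U) (f u) + imbalance (arcs D A) (f u)
      ≡⟨ UA-cancel (f u) ⟩
    0ℤ ∎
    where open ≡-Reasoning
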